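{- (Uniqueness of types up to conversion.) Let $g:\mathbb N\to\mathbb N$ satisfy $h<g(h)$ for all $h$. For every environment $C$ and terms $T,T_1,T_2$: if $C\vdash_g T:T_1$ and $C\vdash_g T:T_2$, then $C\vdash T_1\Leftrightarrow T_2$.
   Context: Terms of $\lambda\delta$: $T ::= \ast h \mid x \mid \lambda x{:}W.\,T \mid \delta x{=}V.\,T \mid \mathrm{appl}(V,T) \mid \mathrm{cast}(W,T)$ ($h\in\mathbb N$, $x$ a variable); $\ast h$ is a sort, $\lambda x{:}W.T$ abstraction over type $W$, $\delta x{=}V.T$ the abbreviation "let $x=V$ in $T$", $\mathrm{appl}(V,T)$ application of $T$ to argument $V$, $\mathrm{cast}(W,T)$ $T$ annotated with type $W$. In $\lambda x{:}W.T$, $\delta x{=}V.T$, $x$ is bound in $T$ only; $\mathrm{FV}(T)$ free variables; terms up to renaming of bound variables with bound and free names disjoint. Environments: $E ::= \ast h \mid \lambda x{:}W.E \mid \delta x{=}V.E \mid \mathrm{appl}(V,E)\mid\mathrm{cast}(W,E)$. $E.\lambda x{:}W$ (resp. $E.\delta x{=}V$) is $E$ with its terminal sort $\ast h$ replaced by $\lambda x{:}W.\ast h$ (resp. $\delta x{=}V.\ast h$). $E=C_1\cdot\beta\cdot C_2$, for an item $\beta$ of the form $\lambda x{:}W$ or $\delta x{=}V$, means $E$ is obtained from the environment $C_1$ by replacing its terminal sort with $\beta.C_2$ for some environment $C_2$. Strict substitution: $T[x:=^+W]\,T'$ iff $x\notin\mathrm{FV}(W)$, $x\in\mathrm{FV}(T)$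 and $T'$ arises from $T$ by replacing a nonempty set of free occurrences of $x$ by $W$. Environment-free parallel reduction $\to_0$: least relation closed under (refl) $T\to_0T$; (compatibility) if $A_1\to_0A_2$, $T_1\to_0T_2$ then $\lambda x{:}A_1.T_1\to_0\lambda x{:}A_2.T_2$, $\delta x{=}A_1.T_1\to_0\delta x{=}A_2.T_2$, $\mathrm{appl}(A_1,T_1)\to_0\mathrm{appl}(A_2,T_2)$, $\mathrm{cast}(A_1,T_1)\to_0\mathrm{cast}(A_2,T_2)$; ($\beta$) if $V_1\to_0V_2$, $T_1\to_0T_2$ then $\mathrm{appl}(V_1,\lambda x{:}W.T_1)\to_0\delta x{=}V_2.T_2$; ($\delta$) if $V_1\to_0V_2$, $T_1\to_0T_2$, $T_2[x:=^+V_2]T$ then $\delta x{=}V_1.T_1\to_0\delta x{=}V_2.T$; ($\zeta$) if $T_1\to_0T_2$, $x\notin\mathrm{FV}(T_1)$ then $\delta x{=}V.T_1\to_0T_2$; ($\tau$) if $T_1\to_0T_2$ then $\mathrm{cast}(W,T_1)\to_0T_2$; ($\upsilon$) if $V_1\to_0V_3$, $V_2\to_0V_4$, $T_1\to_0T_2$ then $\mathrm{appl}(V_1,\delta x{=}V_2.T_1)\to_0\delta x{=}V_4.\mathrm{appl}(V_3,T_2)$. $E\vdash T_1\to T_2$ iff $T_1\to_0T_2$, or $E=C_1\cdot\delta x{=}V\cdot C_2$, $T_1\to_0T'$, $T'[x:=^+V]T_2$. Conversion $E\vdash T_1\Leftrightarrow T_2$ is its symmetric and transitive closure. Native type assignment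 $E\vdash_g T:U$ is the least relation closed under: (sort) $E\vdash_g\ast h:\ast g(h)$; (def) if $E=C_1\cdot\delta x{=}V\cdot C_2$ and $C_1\vdash_g V:W$ then $E\vdash_g x:W$; (decl) if $E=C_1\cdot\lambda x{:}W\cdot C_2$ and $C_1\vdash_g W:V$ then $E\vdash_g x:W$; (abbr) if $E\vdash_g V:W$ and $E.\delta x{=}V\vdash_g T:U$ then $E\vdash_g\delta x{=}V.T:\delta x{=}V.U$; (abst) if $E\vdash_g W:V$ and $E.\lambda x{:}W\vdash_g T:U$ then $E\vdash_g\lambda x{:}W.T:\lambda x{:}W.U$; (appl) if $E\vdash_g V:W$ and $E\vdash_g T:\lambda x{:}W.U$ then $E\vdash_g\mathrm{appl}(V,T):\mathrm{appl}(V,\lambda x{:}W.U)$; (cast) if $E\vdash_g T:W$ and $E\vdash_g W:V$ then $E\vdash_g\mathrm{cast}(W,T):\mathrm{cast}(V,W)$; (conv) if $E\vdash_g U_2:W$, $E\vdash_g T:U_1$ and $E\vdash U_1\Leftrightarrow U_2$ then $E\vdash_g T:U_2$. -}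

module Defs where

-- The calculus λδ with de Bruijn indices (terms are taken up to renaming of
-- bound variables in the paper; de Bruijn indices realise exactly this).

open import Data.Nat using (ℕ; zero; suc; _+_; _<_; _≤?_)
open import Data.Bool using (Bool; true; false; _∨_)
open import Data.Product using (Σ; ∃; _×_; _,_)
open import Data.Sum using (_⊎_)
open import Relation.Nullary using (yes; no)
open import Relation.Binary.PropositionalEquality using (_≡_)

data Term : Set where
  sort : ℕ → Term
  var  : ℕ → Term
  abst : Term → Term → Term       -- λx:W.T   (abst W T, binds in T)
  abbr : Term → Term → Term       -- δx=V.T   (abbr V T, binds in T)
  appl : Term → Term → Term
  cast : Term → Term → Term

lift : ℕ → ℕ → Term → Term
lift n c (sort h) = sort h
lift n c (var i) with c ≤? i
... | yes _ = var (n + i)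
... | no  _ = var i
lift n c (abst W T) = abst (lift n c W) (lift n (suc c) T)
lift n c (abbr V T) = abbr (lift n c V) (lift n (suc c) T)
lift n c (appl V T) = appl (lift n c V) (lift n c T)
lift n c (cast W T) = cast (lift n c W) (lift n c T)

↑ : Term → Term
↑ = lift 1 0

-- Rep d V T T' b : the variable x has index d in the scope of T, V lives in
-- the scope just outside the binder of x, and T' arises from T by replacing
-- some set of free occurrences of x by V (suitably lifted); b = true iff
-- that set is nonempty.  (x ∉ FV(V) holds automatically with this scoping.)

data Rep (d : ℕ) (V : Term) : Term → Term → Bool → Set where
  r-sort : ∀ {h} → Rep d V (sort h) (sort h) false
  r-var  : ∀ {i} → Rep d V (var i) (var i) false
  r-hit  : Rep d V (var d) (lift (suc d) 0 V) true
  r-abst : ∀ {W W' T T' b₁ b₂} → Rep d V W W' b₁ → Rep (suc d) V T T' b₂ →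
           Rep d V (abst W T) (abst W' T') (b₁ ∨ b₂)
  r-abbr : ∀ {W W' T T' b₁ b₂} → Rep d V W W' b₁ → Rep (suc d) V T T' b₂ →
           Rep d V (abbr W T) (abbr W' T') (b₁ ∨ b₂)
  r-appl : ∀ {W W' T T' b₁ b₂} → Rep d V W W' b₁ → Rep d V T T' b₂ →
           Rep d V (appl W T) (appl W' T') (b₁ ∨ b₂)
  r-cast : ∀ {W W' T T' b₁ b₂} → Rep d V W W' b₁ → Rep d V T T' b₂ →
           Rep d V (cast W T) (cast W' T') (b₁ ∨ b₂)

StrictSubst : ℕ → Term → Term → Term → Set
StrictSubst d V T T' = Rep d V T T' true

infix 4 _→₀_
data _→₀_ : Term → Term → Set where
  refl₀ : ∀ {T} → T →₀ T
  c-abst : ∀ {A₁ A₂ T₁ T₂} → A₁ →₀ A₂ → T₁ →₀ T₂ → abst A₁ T₁ →₀ abst A₂ T₂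
  c-abbr : ∀ {A₁ A₂ T₁ T₂} → A₁ →₀ A₂ → T₁ →₀ T₂ → abbr A₁ T₁ →₀ abbr A₂ T₂
  c-appl : ∀ {A₁ A₂ T₁ T₂} → A₁ →₀ A₂ → T₁ →₀ T₂ → appl A₁ T₁ →₀ appl A₂ T₂
  c-cast : ∀ {A₁ A₂ T₁ T₂} → A₁ →₀ A₂ → T₁ →₀ T₂ → cast A₁ T₁ →₀ cast A₂ T₂
  β₀ : ∀ {V₁ V₂ W T₁ T₂} → V₁ →₀ V₂ → T₁ →₀ T₂ →
       appl V₁ (abst W T₁) →₀ abbr V₂ T₂
  δ₀ : ∀ {V₁ V₂ T₁ T₂ T} → V₁ →₀ V₂ → T₁ →₀ T₂ → StrictSubst 0 V₂ T₂ T →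
       abbr V₁ T₁ →₀ abbr V₂ T
  -- x ∉ FV(T₁) is expressed as T₁ = ↑ T₁' (T₁' the same term outside x's scope)
  ζ₀ : ∀ {V T₁ T₂} → T₁ →₀ T₂ → abbr V (↑ T₁) →₀ T₂
  τ₀ : ∀ {W T₁ T₂} → T₁ →₀ T₂ → cast W T₁ →₀ T₂
  υ₀ : ∀ {V₁ V₂ V₃ V₄ T₁ T₂} → V₁ →₀ V₃ → V₂ →₀ V₄ → T₁ →₀ T₂ →
       appl V₁ (abbr V₂ T₁) →₀ abbr V₄ (appl (↑ V₃) T₂)

data Env : Set where
  esort : ℕ → Env
  eabst : Term → Env → Env
  eabbr : Term → Env → Env
  eappl : Term → Env → Env
  ecast : Term → Env → Env

data Item : Set where
  λ-item : Term → Item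
  δ-item : Term → Item

_∷ₑ_ : Item → Env → Env
λ-item W ∷ₑ C = eabst W C
δ-item V ∷ₑ C = eabbr V C

_·_·_ : Env → Item → Env → Env
esort h   · β · C₂ = β ∷ₑ C₂
eabst W C · β · C₂ = eabst W (C · β · C₂)
eabbr V C · β · C₂ = eabbr V (C · β · C₂)
eappl V C · β · C₂ = eappl V (C · β · C₂)
ecast W C · β · C₂ = ecast W (C · β · C₂)

_▸_ : Env → Item → Env
esort h   ▸ β = β ∷ₑ esort h
eabst W C ▸ β = eabst W (C ▸ β)
eabbr V C ▸ β = eabbr V (C ▸ β)
eappl V C ▸ β = eappl V (C ▸ β)
ecast W C ▸ β = ecast W (C ▸ β)

-- number of binding items (λ, δ) of an environment; the variable bound by
-- β in C₁·β·C₂ has de Bruijn index (binders C₂).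
binders : Env → ℕ
binders (esort h)   = 0
binders (eabst W C) = suc (binders C)
binders (eabbr V C) = suc (binders C)
binders (eappl V C) = binders C
binders (ecast W C) = binders C

infix 4 _⊢_⟶_ _⊢_⇔_
data _⊢_⟶_ (E : Env) (T₁ T₂ : Term) : Set where
  free  : T₁ →₀ T₂ → E ⊢ T₁ ⟶ T₂
  unfold : ∀ C₁ V C₂ T' → E ≡ C₁ · δ-item V · C₂ → T₁ →₀ T' →
           StrictSubst (binders C₂) V T' T₂ → E ⊢ T₁ ⟶ T₂

data _⊢_⇔_ (E : Env) : Term → Term → Set where
  step  : ∀ {T₁ T₂} → E ⊢ T₁ ⟶ T₂ → E ⊢ T₁ ⇔ T₂
  symm  : ∀ {T₁ T₂} → E ⊢ T₁ ⇔ T₂ → E ⊢ T₂ ⇔ T₁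
  trans : ∀ {T₁ T₂ T₃} → E ⊢ T₁ ⇔ T₂ → E ⊢ T₂ ⇔ T₃ → E ⊢ T₁ ⇔ T₃

data _⊢[_]_∶_ : Env → (ℕ → ℕ) → Term → Term → Set where
  t-sort : ∀ {E g h} → E ⊢[ g ] sort h ∶ sort (g h)
  t-def  : ∀ {E g C₁ V C₂ W} → E ≡ C₁ · δ-item V · C₂ → C₁ ⊢[ g ] V ∶ W →
           E ⊢[ g ] var (binders C₂) ∶ lift (suc (binders C₂)) 0 W
  t-decl : ∀ {E g C₁ W C₂ V} → E ≡ C₁ · λ-item W · C₂ → C₁ ⊢[ g ] W ∶ V →
           E ⊢[ g ] var (binders C₂) ∶ lift (suc (binders C₂)) 0 W
  t-abbr : ∀ {E g V W T U} → E ⊢[ g ] V ∶ W → (E ▸ δ-item V) ⊢[ g ] T ∶ U →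
           E ⊢[ g ] abbr V T ∶ abbr V U
  t-abst : ∀ {E g W V T U} → E ⊢[ g ] W ∶ V → (E ▸ λ-item W) ⊢[ g ] T ∶ U →
           E ⊢[ g ] abst W T ∶ abst W U
  t-appl : ∀ {E g V W T U} → E ⊢[ g ] V ∶ W → E ⊢[ g ] T ∶ abst W U →
           E ⊢[ g ] appl V T ∶ appl V (abst W U)
  t-cast : ∀ {E g T W V} → E ⊢[ g ] T ∶ W → E ⊢[ g ] W ∶ V →
           E ⊢[ g ] cast W T ∶ cast V W
  t-conv : ∀ {E g T U₁ U₂ W} → E ⊢[ g ] U₂ ∶ W → E ⊢[ g ] T ∶ U₁ →
           E ⊢ U₁ ⇔ U₂ → E ⊢[ g ] T ∶ U₂

{-# OPTIONS --safe #-}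
-- Conversion steps are absorbed by symmetry and transitivity
-- of ⇔; otherwise both derivations end with the same syntax-directed rule, and both types are
-- built from the types of the premises by the same context (abbr V, abst W, appl V, cast · W),
-- which preserves conversion.  A variable points to the same binder in both derivations: for
-- λx:W both types are W, and for δx=V the two types of V are convertible in the prefix
-- environment, hence so are their lifts into the whole environment.
module Submission where

open import Defs
open import Data.Nat using (ℕ; suc; _+_; _≤_; _<_; z≤n; s≤s; _≤?_)
open import Data.Nat.Properties
open import Algebra.Properties.CommutativeSemigroup +-commutativeSemigroup using (x∙yz≈y∙xz)
open import Data.Bool using (false)
open import Data.List using (List; []; _∷_; _++_; _∷ʳ_; [_])
open import Data.List.Properties using (∷-injective; ∷ʳ-injective; ++-assoc)
open import Data.List.Reverse using (reverseView; []; _∶_∶ʳ_)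
open import Data.Product using (∃-syntax; _×_; _,_; map₁)
open import Data.Sum using (_⊎_; inj₁; inj₂)
open import Data.Empty using (⊥-elim)
open import Function using (id)
open import Relation.Nullary using (yes; no; contradiction)
open import Relation.Binary.PropositionalEquality
  using (_≡_; refl; sym; cong; cong₂; subst; module ≡-Reasoning)
  renaming (trans to ≡-trans)

lift-var-≥ : ∀ n {c i} → c ≤ i → lift n c (var i) ≡ var (n + i)
lift-var-≥ n {c} {i} c≤i with c ≤? i
... | yes _   = refl
... | no  c≰i = contradiction c≤i c≰i

lift-var-< : ∀ n {c i} → i < c → lift n c (var i) ≡ var i
lift-var-< n {c} {i} i<c with c ≤? i
... | yes c≤i = contradiction c≤i (<⇒≱ i<c)
... | no  _   = refl

lift-lift-commute : ∀ n m k c T → k ≤ c →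
                    lift n (c + m) (lift m k T) ≡ lift m k (lift n c T)
lift-lift-commute n m k c (sort h) k≤c = refl
lift-lift-commute n m k c (var i) k≤c with ≤-<-connex k i
... | inj₂ i<k
  rewrite lift-var-< m i<k
        | lift-var-< n (<-≤-trans i<k (≤-trans k≤c (m≤m+n c m)))
        | lift-var-< n (<-≤-trans i<k k≤c)
        | lift-var-< m i<k = refl
... | inj₁ k≤i with ≤-<-connex c i
...   | inj₁ c≤i
  rewrite lift-var-≥ m k≤i
        | lift-var-≥ n (subst (_≤ m + i) (+-comm m c) (+-monoʳ-≤ m c≤i))
        | lift-var-≥ n c≤i
        | lift-var-≥ m (≤-trans k≤i (m≤n+m i n)) = cong var (x∙yz≈y∙xz n m i)
...   | inj₂ i<c
  rewrite lift-var-≥ m k≤i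
        | lift-var-< n (subst (m + i <_) (+-comm m c) (+-monoʳ-< m i<c))
        | lift-var-< n i<c
        | lift-var-≥ m k≤i = refl
lift-lift-commute n m k c (abst W T) k≤c =
  cong₂ abst (lift-lift-commute n m k c W k≤c) (lift-lift-commute n m (suc k) (suc c) T (s≤s k≤c))
lift-lift-commute n m k c (abbr V T) k≤c =
  cong₂ abbr (lift-lift-commute n m k c V k≤c) (lift-lift-commute n m (suc k) (suc c) T (s≤s k≤c))
lift-lift-commute n m k c (appl V T) k≤c =
  cong₂ appl (lift-lift-commute n m k c V k≤c) (lift-lift-commute n m k c T k≤c)
lift-lift-commute n m k c (cast W T) k≤c =
  cong₂ cast (lift-lift-commute n m k c W k≤c) (lift-lift-commute n m k c T k≤c)

lift-lift-merge : ∀ n m k c T → k ≤ c → c ≤ k + m → lift n c (lift m k T) ≡ lift (n + m) k T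
lift-lift-merge n m k c (sort h) k≤c c≤k+m = refl
lift-lift-merge n m k c (var i) k≤c c≤k+m with ≤-<-connex k i
... | inj₂ i<k
  rewrite lift-var-< m i<k
        | lift-var-< n (<-≤-trans i<k k≤c)
        | lift-var-< (n + m) i<k = refl
... | inj₁ k≤i
  rewrite lift-var-≥ m k≤i
        | lift-var-≥ n (≤-trans c≤k+m (subst (k + m ≤_) (+-comm i m) (+-monoˡ-≤ m k≤i)))
        | lift-var-≥ (n + m) k≤i = cong var (sym (+-assoc n m i))
lift-lift-merge n m k c (abst W T) k≤c c≤k+m =
  cong₂ abst (lift-lift-merge n m k c W k≤c c≤k+m) (lift-lift-merge n m (suc k) (suc c) T (s≤s k≤c) (s≤s c≤k+m))
lift-lift-merge n m k c (abbr V T) k≤c c≤k+m =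
  cong₂ abbr (lift-lift-merge n m k c V k≤c c≤k+m) (lift-lift-merge n m (suc k) (suc c) T (s≤s k≤c) (s≤s c≤k+m))
lift-lift-merge n m k c (appl V T) k≤c c≤k+m =
  cong₂ appl (lift-lift-merge n m k c V k≤c c≤k+m) (lift-lift-merge n m k c T k≤c c≤k+m)
lift-lift-merge n m k c (cast W T) k≤c c≤k+m =
  cong₂ cast (lift-lift-merge n m k c W k≤c c≤k+m) (lift-lift-merge n m k c T k≤c c≤k+m)

lift-↑ : ∀ n c T → lift n (suc c) (↑ T) ≡ ↑ (lift n c T)
lift-↑ n c T = subst (λ c′ → lift n c′ (↑ T) ≡ ↑ (lift n c T)) (+-comm c 1) (lift-lift-commute n 1 0 c T z≤n)

Rep-refl : ∀ d V T → Rep d V T T false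
Rep-refl d V (sort h)   = r-sort
Rep-refl d V (var i)    = r-var
Rep-refl d V (abst W T) = r-abst (Rep-refl d V W) (Rep-refl (suc d) V T)
Rep-refl d V (abbr W T) = r-abbr (Rep-refl d V W) (Rep-refl (suc d) V T)
Rep-refl d V (appl W T) = r-appl (Rep-refl d V W) (Rep-refl d V T)
Rep-refl d V (cast W T) = r-cast (Rep-refl d V W) (Rep-refl d V T)

Rep-lift-above : ∀ n c {d U T T′ b} → Rep d U T T′ b →
                 Rep d (lift n c U) (lift n (suc d + c) T) (lift n (suc d + c) T′) b
Rep-lift-above n c r-sort = Rep-refl _ _ _
Rep-lift-above n c r-var  = Rep-refl _ _ _
Rep-lift-above n c {d} {U} r-hit
  rewrite lift-var-< n {suc d + c} (s≤s (m≤m+n d c))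
        | +-comm (suc d) c
        | lift-lift-commute n (suc d) 0 c U z≤n = r-hit
Rep-lift-above n c (r-abst r₁ r₂) = r-abst (Rep-lift-above n c r₁) (Rep-lift-above n c r₂)
Rep-lift-above n c (r-abbr r₁ r₂) = r-abbr (Rep-lift-above n c r₁) (Rep-lift-above n c r₂)
Rep-lift-above n c (r-appl r₁ r₂) = r-appl (Rep-lift-above n c r₁) (Rep-lift-above n c r₂)
Rep-lift-above n c (r-cast r₁ r₂) = r-cast (Rep-lift-above n c r₁) (Rep-lift-above n c r₂)

Rep-lift-below : ∀ n c {d U T T′ b} → c ≤ d → Rep d U T T′ b →
                 Rep (d + n) U (lift n c T) (lift n c T′) b
Rep-lift-below n c c≤d r-sort = Rep-refl _ _ _
Rep-lift-below n c c≤d r-var  = Rep-refl _ _ _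
Rep-lift-below n c {d} {U} c≤d r-hit
  rewrite lift-var-≥ n c≤d
        | lift-lift-merge n (suc d) 0 c U z≤n (m≤n⇒m≤1+n c≤d)
        | +-suc n d
        | +-comm n d = r-hit
Rep-lift-below n c c≤d (r-abst r₁ r₂) =
  r-abst (Rep-lift-below n c c≤d r₁) (Rep-lift-below n (suc c) (s≤s c≤d) r₂)
Rep-lift-below n c c≤d (r-abbr r₁ r₂) =
  r-abbr (Rep-lift-below n c c≤d r₁) (Rep-lift-below n (suc c) (s≤s c≤d) r₂)
Rep-lift-below n c c≤d (r-appl r₁ r₂) = r-appl (Rep-lift-below n c c≤d r₁) (Rep-lift-below n c c≤d r₂)
Rep-lift-below n c c≤d (r-cast r₁ r₂) = r-cast (Rep-lift-below n c c≤d r₁) (Rep-lift-below n c c≤d r₂)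

lift-→₀ : ∀ n c {T₁ T₂} → T₁ →₀ T₂ → lift n c T₁ →₀ lift n c T₂
lift-→₀ n c refl₀        = refl₀
lift-→₀ n c (c-abst p q) = c-abst (lift-→₀ n c p) (lift-→₀ n (suc c) q)
lift-→₀ n c (c-abbr p q) = c-abbr (lift-→₀ n c p) (lift-→₀ n (suc c) q)
lift-→₀ n c (c-appl p q) = c-appl (lift-→₀ n c p) (lift-→₀ n c q)
lift-→₀ n c (c-cast p q) = c-cast (lift-→₀ n c p) (lift-→₀ n c q)
lift-→₀ n c (β₀ p q)     = β₀ (lift-→₀ n c p) (lift-→₀ n (suc c) q)
lift-→₀ n c (δ₀ p q r)   = δ₀ (lift-→₀ n c p) (lift-→₀ n (suc c) q) (Rep-lift-above n c r)
lift-→₀ n c (ζ₀ {T₁ = T₁} p)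
  rewrite lift-↑ n c T₁ = ζ₀ (lift-→₀ n c p)
lift-→₀ n c (τ₀ p)       = τ₀ (lift-→₀ n c p)
lift-→₀ n c (υ₀ {V₃ = V₃} p q s)
  rewrite lift-↑ n c V₃ = υ₀ (lift-→₀ n c p) (lift-→₀ n c q) (lift-→₀ n (suc c) s)

data Frame : Set where
  bind       : Item → Frame
  appl-frame : Term → Frame
  cast-frame : Term → Frame

frames : Env → List Frame
frames (esort h)   = []
frames (eabst W C) = bind (λ-item W) ∷ frames C
frames (eabbr V C) = bind (δ-item V) ∷ frames C
frames (eappl V C) = appl-frame V ∷ frames C
frames (ecast W C) = cast-frame W ∷ frames C

terminal : Env → ℕ
terminal (esort h)   = h
terminal (eabst W C) = terminal C
terminal (eabbr V C) = terminal C
terminal (eappl V C) = terminal C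
terminal (ecast W C) = terminal C

fromFrames : List Frame → ℕ → Env
fromFrames []                  h = esort h
fromFrames (bind β ∷ fs)       h = β ∷ₑ fromFrames fs h
fromFrames (appl-frame V ∷ fs) h = eappl V (fromFrames fs h)
fromFrames (cast-frame W ∷ fs) h = ecast W (fromFrames fs h)

fromFrames-frames : ∀ E → fromFrames (frames E) (terminal E) ≡ E
fromFrames-frames (esort h)   = refl
fromFrames-frames (eabst W C) = cong (eabst W) (fromFrames-frames C)
fromFrames-frames (eabbr V C) = cong (eabbr V) (fromFrames-frames C)
fromFrames-frames (eappl V C) = cong (eappl V) (fromFrames-frames C)
fromFrames-frames (ecast W C) = cong (ecast W) (fromFrames-frames C)

fromFrames-· : ∀ C₁ β fs h → fromFrames (frames C₁ ++ bind β ∷ fs) h ≡ C₁ · β · fromFrames fs h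
fromFrames-· (esort _)   β fs h = refl
fromFrames-· (eabst W C) β fs h = cong (eabst W) (fromFrames-· C β fs h)
fromFrames-· (eabbr V C) β fs h = cong (eabbr V) (fromFrames-· C β fs h)
fromFrames-· (eappl V C) β fs h = cong (eappl V) (fromFrames-· C β fs h)
fromFrames-· (ecast W C) β fs h = cong (ecast W) (fromFrames-· C β fs h)

frames-· : ∀ C₁ β C₂ → frames (C₁ · β · C₂) ≡ frames C₁ ++ bind β ∷ frames C₂
frames-· (esort _)   (λ-item W) C₂ = refl
frames-· (esort _)   (δ-item V) C₂ = refl
frames-· (eabst W C) β C₂ = cong (bind (λ-item W) ∷_) (frames-· C β C₂)
frames-· (eabbr V C) β C₂ = cong (bind (δ-item V) ∷_) (frames-· C β C₂)
frames-· (eappl V C) β C₂ = cong (appl-frame V ∷_) (frames-· C β C₂)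
frames-· (ecast W C) β C₂ = cong (cast-frame W ∷_) (frames-· C β C₂)

frames-▸ : ∀ E β → frames (E ▸ β) ≡ frames E ∷ʳ bind β
frames-▸ (esort _)   (λ-item W) = refl
frames-▸ (esort _)   (δ-item V) = refl
frames-▸ (eabst W C) β = cong (bind (λ-item W) ∷_) (frames-▸ C β)
frames-▸ (eabbr V C) β = cong (bind (δ-item V) ∷_) (frames-▸ C β)
frames-▸ (eappl V C) β = cong (appl-frame V ∷_) (frames-▸ C β)
frames-▸ (ecast W C) β = cong (cast-frame W ∷_) (frames-▸ C β)

·-fromFrames : ∀ {E} C₁ β fs → frames E ≡ frames C₁ ++ bind β ∷ fs →
               E ≡ C₁ · β · fromFrames fs (terminal E)
·-fromFrames {E} C₁ β fs eq = begin
  E                                                  ≡⟨ sym (fromFrames-frames E) ⟩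
  fromFrames (frames E) (terminal E)                 ≡⟨ cong (λ fs′ → fromFrames fs′ (terminal E)) eq ⟩
  fromFrames (frames C₁ ++ bind β ∷ fs) (terminal E) ≡⟨ fromFrames-· C₁ β fs (terminal E) ⟩
  C₁ · β · fromFrames fs (terminal E)                ∎
  where open ≡-Reasoning

bound : List Frame → ℕ
bound []                  = 0
bound (bind _ ∷ fs)       = suc (bound fs)
bound (appl-frame _ ∷ fs) = bound fs
bound (cast-frame _ ∷ fs) = bound fs

binders-frames : ∀ E → binders E ≡ bound (frames E)
binders-frames (esort h)   = refl
binders-frames (eabst W C) = cong suc (binders-frames C)
binders-frames (eabbr V C) = cong suc (binders-frames C)
binders-frames (eappl V C) = binders-frames C
binders-frames (ecast W C) = binders-frames C

binders-fromFrames : ∀ fs h → binders (fromFrames fs h) ≡ bound fs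
binders-fromFrames []                     h = refl
binders-fromFrames (bind (λ-item W) ∷ fs) h = cong suc (binders-fromFrames fs h)
binders-fromFrames (bind (δ-item V) ∷ fs) h = cong suc (binders-fromFrames fs h)
binders-fromFrames (appl-frame V ∷ fs)    h = binders-fromFrames fs h
binders-fromFrames (cast-frame W ∷ fs)    h = binders-fromFrames fs h

bound-++-bind : ∀ xs β ys → bound (xs ++ bind β ∷ ys) ≡ suc (bound xs + bound ys)
bound-++-bind []                  β ys = refl
bound-++-bind (bind _ ∷ xs)       β ys = cong suc (bound-++-bind xs β ys)
bound-++-bind (appl-frame _ ∷ xs) β ys = bound-++-bind xs β ys
bound-++-bind (cast-frame _ ∷ xs) β ys = bound-++-bind xs β ys

binders-· : ∀ C₁ β C₂ → binders (C₁ · β · C₂) ≡ binders C₁ + suc (binders C₂)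
binders-· (esort h)   (λ-item W) C₂ = refl
binders-· (esort h)   (δ-item V) C₂ = refl
binders-· (eabst W C) β C₂ = cong suc (binders-· C β C₂)
binders-· (eabbr V C) β C₂ = cong suc (binders-· C β C₂)
binders-· (eappl V C) β C₂ = binders-· C β C₂
binders-· (ecast W C) β C₂ = binders-· C β C₂

·-assoc : ∀ A β B β′ C → ((A · β · B) · β′ · C) ≡ (A · β · (B · β′ · C))
·-assoc (esort h)   (λ-item W) B β′ C = refl
·-assoc (esort h)   (δ-item V) B β′ C = refl
·-assoc (eabst W A) β B β′ C = cong (eabst W) (·-assoc A β B β′ C)
·-assoc (eabbr V A) β B β′ C = cong (eabbr V) (·-assoc A β B β′ C)
·-assoc (eappl V A) β B β′ C = cong (eappl V) (·-assoc A β B β′ C)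
·-assoc (ecast W A) β B β′ C = cong (ecast W) (·-assoc A β B β′ C)

++-bind-injective : ∀ xs xs′ {β β′ ys ys′} → xs ++ bind β ∷ ys ≡ xs′ ++ bind β′ ∷ ys′ →
                    bound ys ≡ bound ys′ → xs ≡ xs′ × β ≡ β′
++-bind-injective []       []        refl _ = refl , refl
++-bind-injective []       (_ ∷ xs′) refl b = ⊥-elim (m≢1+n+m _ (≡-trans (sym b) (bound-++-bind xs′ _ _)))
++-bind-injective (_ ∷ xs) []        refl b = ⊥-elim (m≢1+n+m _ (≡-trans b (bound-++-bind xs _ _)))
++-bind-injective (x ∷ xs) (_ ∷ xs′) eq   b with refl , eq′ ← ∷-injective eq =
  map₁ (cong (x ∷_)) (++-bind-injective xs xs′ eq′ b)

∷ʳ-≡-++-∷ : ∀ {ℓ} {A : Set ℓ} xs ys zs {a b : A} → xs ∷ʳ a ≡ ys ++ b ∷ zs →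
            (xs ≡ ys × a ≡ b × zs ≡ []) ⊎ ∃[ zs′ ] xs ≡ ys ++ b ∷ zs′ × zs ≡ zs′ ∷ʳ a
∷ʳ-≡-++-∷ xs ys zs {b = b} eq with reverseView zs
... | [] with xs≡ys , a≡b ← ∷ʳ-injective xs ys eq = inj₁ (xs≡ys , a≡b , refl)
... | zs′ ∶ _ ∶ʳ c
  with xs≡ , a≡c ← ∷ʳ-injective xs (ys ++ b ∷ zs′) (≡-trans eq (sym (++-assoc ys (b ∷ zs′) [ c ]))) =
  inj₂ (zs′ , xs≡ , cong (zs′ ∷ʳ_) (sym a≡c))

-- C₁ · β · C₂ forgets the terminal sort of C₁, so a decomposition of an environment determines
-- its prefix only up to ≈; the induction therefore relates derivations in ≈-environments.
infix 4 _≈_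
_≈_ : Env → Env → Set
E ≈ E′ = frames E ≡ frames E′

≈-▸ : ∀ {E E′} β → E ≈ E′ → E ▸ β ≈ E′ ▸ β
≈-▸ {E} {E′} β E≈E′ = begin
  frames (E ▸ β)       ≡⟨ frames-▸ E β ⟩
  frames E ∷ʳ bind β   ≡⟨ cong (_∷ʳ bind β) E≈E′ ⟩
  frames E′ ∷ʳ bind β  ≡⟨ frames-▸ E′ β ⟨
  frames (E′ ▸ β)      ∎
  where open ≡-Reasoning

·-≈-injective : ∀ C₁ β C₂ C₁′ β′ C₂′ → (C₁ · β · C₂) ≈ (C₁′ · β′ · C₂′) →
                binders C₂ ≡ binders C₂′ → C₁ ≈ C₁′ × β ≡ β′
·-≈-injective C₁ β C₂ C₁′ β′ C₂′ E≈E′ b =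
  ++-bind-injective (frames C₁) (frames C₁′)
    (≡-trans (sym (frames-· C₁ β C₂)) (≡-trans E≈E′ (frames-· C₁′ β′ C₂′)))
    (≡-trans (sym (binders-frames C₂)) (≡-trans b (binders-frames C₂′)))

≈-· : ∀ {E} C₁ β C₂ → (C₁ · β · C₂) ≈ E → ∃[ C₂′ ] E ≡ C₁ · β · C₂′ × binders C₂′ ≡ binders C₂
≈-· {E} C₁ β C₂ E≈E′ =
  fromFrames (frames C₂) (terminal E) ,
  ·-fromFrames C₁ β (frames C₂) (≡-trans (sym E≈E′) (frames-· C₁ β C₂)) ,
  ≡-trans (binders-fromFrames (frames C₂) (terminal E)) (sym (binders-frames C₂))

▸-≡-· : ∀ E β C₁ β′ C₂ → E ▸ β ≡ C₁ · β′ · C₂ →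
        (β ≡ β′ × binders C₂ ≡ 0) ⊎ ∃[ C ] E ≡ C₁ · β′ · C × binders C₂ ≡ suc (binders C)
▸-≡-· E β C₁ β′ C₂ eq
  with ∷ʳ-≡-++-∷ (frames E) (frames C₁) (frames C₂)
         (≡-trans (sym (frames-▸ E β)) (≡-trans (cong frames eq) (frames-· C₁ β′ C₂)))
... | inj₁ (_ , refl , C₂-empty) = inj₁ (refl , ≡-trans (binders-frames C₂) (cong bound C₂-empty))
... | inj₂ (fs , E-frames , C₂-frames) =
  inj₂ (fromFrames fs (terminal E) , ·-fromFrames C₁ β′ fs E-frames , binders-C₂)
  where
  open ≡-Reasoning
  binders-C₂ : binders C₂ ≡ suc (binders (fromFrames fs (terminal E)))
  binders-C₂ = begin
    binders C₂                                 ≡⟨ binders-frames C₂ ⟩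
    bound (frames C₂)                          ≡⟨ cong bound C₂-frames ⟩
    bound (fs ∷ʳ bind β)                       ≡⟨ bound-++-bind fs β [] ⟩
    suc (bound fs + 0)                         ≡⟨ cong suc (+-identityʳ (bound fs)) ⟩
    suc (bound fs)                             ≡⟨ cong suc (binders-fromFrames fs (terminal E)) ⟨
    suc (binders (fromFrames fs (terminal E))) ∎

⇔-refl : ∀ {E T} → E ⊢ T ⇔ T
⇔-refl = step (free refl₀)

⇔-map : ∀ {E E′} (f : Term → Term) → (∀ {T U} → E ⊢ T ⟶ U → E′ ⊢ f T ⟶ f U) →
        ∀ {T U} → E ⊢ T ⇔ U → E′ ⊢ f T ⇔ f U
⇔-map f f-step (step s)    = step (f-step s)
⇔-map f f-step (symm p)    = symm (⇔-map f f-step p)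
⇔-map f f-step (trans p q) = trans (⇔-map f f-step p) (⇔-map f f-step q)

⟶-≈ : ∀ {E E′ T U} → E ≈ E′ → E ⊢ T ⟶ U → E′ ⊢ T ⟶ U
⟶-≈ E≈E′ (free p) = free p
⟶-≈ E≈E′ (unfold C₁ V C₂ T′ refl p rep) with C₂′ , E′≡ , b ← ≈-· C₁ (δ-item V) C₂ E≈E′ =
  unfold C₁ V C₂′ T′ E′≡ p (subst (λ d → StrictSubst d V T′ _) (sym b) rep)

⇔-≈ : ∀ {E E′ T U} → E ≈ E′ → E ⊢ T ⇔ U → E′ ⊢ T ⇔ U
⇔-≈ E≈E′ = ⇔-map id (⟶-≈ E≈E′)

⟶-weaken : ∀ C₁ β C₂ {T U} → C₁ ⊢ T ⟶ U →
           C₁ · β · C₂ ⊢ lift (suc (binders C₂)) 0 T ⟶ lift (suc (binders C₂)) 0 U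
⟶-weaken C₁ β C₂ (free p) = free (lift-→₀ _ 0 p)
⟶-weaken .(A · δ-item V · B) β C₂ {U = U} (unfold A V B T′ refl p rep) =
  unfold A V (B · β · C₂) (lift n 0 T′) (·-assoc A (δ-item V) B β C₂) (lift-→₀ n 0 p)
    (subst (λ d → StrictSubst d V (lift n 0 T′) (lift n 0 U)) (sym (binders-· B β C₂))
      (Rep-lift-below n 0 z≤n rep))
  where n = suc (binders C₂)

⇔-weaken : ∀ C₁ β C₂ {T U} → C₁ ⊢ T ⇔ U →
           C₁ · β · C₂ ⊢ lift (suc (binders C₂)) 0 T ⇔ lift (suc (binders C₂)) 0 U
⇔-weaken C₁ β C₂ = ⇔-map (lift (suc (binders C₂)) 0) (⟶-weaken C₁ β C₂)

⟶-appl : ∀ {E V T U} → E ⊢ T ⟶ U → E ⊢ appl V T ⟶ appl V U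
⟶-appl (free p) = free (c-appl refl₀ p)
⟶-appl {V = V} (unfold C₁ W C₂ T′ eq p rep) =
  unfold C₁ W C₂ (appl V T′) eq (c-appl refl₀ p) (r-appl (Rep-refl _ _ V) rep)

⟶-cast : ∀ {E W T U} → E ⊢ T ⟶ U → E ⊢ cast T W ⟶ cast U W
⟶-cast (free p) = free (c-cast p refl₀)
⟶-cast {W = W} (unfold C₁ V C₂ T′ eq p rep) =
  unfold C₁ V C₂ (cast T′ W) eq (c-cast p refl₀) (r-cast rep (Rep-refl _ _ W))

⟶-abbr : ∀ E V {T U} → E ▸ δ-item V ⊢ T ⟶ U → E ⊢ abbr V T ⟶ abbr V U
⟶-abbr E V (free p) = free (c-abbr refl₀ p)
⟶-abbr E V {U = U} (unfold C₁ W C₂ T′ eq p rep) with ▸-≡-· E (δ-item V) C₁ (δ-item W) C₂ eq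
... | inj₁ (refl , b) = free (δ₀ refl₀ p (subst (λ d → StrictSubst d V T′ U) b rep))
... | inj₂ (C , eq′ , b) =
  unfold C₁ W C (abbr V T′) eq′ (c-abbr refl₀ p)
    (r-abbr (Rep-refl _ _ V) (subst (λ d → StrictSubst d W T′ U) b rep))

⟶-abst : ∀ E W {T U} → E ▸ λ-item W ⊢ T ⟶ U → E ⊢ abst W T ⟶ abst W U
⟶-abst E W (free p) = free (c-abst refl₀ p)
⟶-abst E W {U = U} (unfold C₁ V C₂ T′ eq p rep) with ▸-≡-· E (λ-item W) C₁ (δ-item V) C₂ eq
... | inj₁ (() , _)
... | inj₂ (C , eq′ , b) =
  unfold C₁ V C (abst W T′) eq′ (c-abst refl₀ p)
    (r-abst (Rep-refl _ _ W) (subst (λ d → StrictSubst d V T′ U) b rep))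

-- A variable rule types var (binders C₂), which is not a pattern, so the indices of the two
-- derivations are related by an explicit equation.
mutual
  types-unique : ∀ {g E E′ T T₁ T₂} → E ≈ E′ → E ⊢[ g ] T ∶ T₁ → E′ ⊢[ g ] T ∶ T₂ → E ⊢ T₁ ⇔ T₂
  types-unique E≈E′ (t-conv _ d₁ p) d₂ = trans (symm p) (types-unique E≈E′ d₁ d₂)
  types-unique E≈E′ d₁@(t-def _ _)  d₂ = var-types-unique E≈E′ d₁ d₂ refl
  types-unique E≈E′ d₁@(t-decl _ _) d₂ = var-types-unique E≈E′ d₁ d₂ refl
  types-unique E≈E′ d₁ (t-conv _ d₂ q) = trans (types-unique E≈E′ d₁ d₂) (⇔-≈ (sym E≈E′) q)
  types-unique E≈E′ t-sort t-sort = ⇔-refl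
  types-unique {E = E} E≈E′ (t-abbr {V = V} _ d₁) (t-abbr _ d₂) =
    ⇔-map (abbr V) (⟶-abbr E V) (types-unique (≈-▸ (δ-item V) E≈E′) d₁ d₂)
  types-unique {E = E} E≈E′ (t-abst {W = W} _ d₁) (t-abst _ d₂) =
    ⇔-map (abst W) (⟶-abst E W) (types-unique (≈-▸ (λ-item W) E≈E′) d₁ d₂)
  types-unique E≈E′ (t-appl {V = V} _ d₁) (t-appl _ d₂) =
    ⇔-map (appl V) ⟶-appl (types-unique E≈E′ d₁ d₂)
  types-unique E≈E′ (t-cast {W = W} _ d₁) (t-cast _ d₂) =
    ⇔-map (λ V → cast V W) ⟶-cast (types-unique E≈E′ d₁ d₂)

  var-types-unique : ∀ {g E E′ i j T₁ T₂} → E ≈ E′ →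
                     E ⊢[ g ] var i ∶ T₁ → E′ ⊢[ g ] var j ∶ T₂ → i ≡ j → E ⊢ T₁ ⇔ T₂
  var-types-unique E≈E′ (t-conv _ d₁ p) d₂ i≡j = trans (symm p) (var-types-unique E≈E′ d₁ d₂ i≡j)
  var-types-unique E≈E′ d₁ (t-conv _ d₂ q) i≡j = trans (var-types-unique E≈E′ d₁ d₂ i≡j) (⇔-≈ (sym E≈E′) q)
  var-types-unique E≈E′ (t-def {C₁ = C₁} {V} {C₂} {W} refl d₁) (t-def {C₁ = C₁′} {V′} {C₂′} {W′} refl d₂) i≡j
    with C₁≈C₁′ , refl ← ·-≈-injective C₁ (δ-item V) C₂ C₁′ (δ-item V′) C₂′ E≈E′ i≡j =
    subst (λ k → C₁ · δ-item V · C₂ ⊢ lift (suc (binders C₂)) 0 W ⇔ lift (suc k) 0 W′) i≡j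
      (⇔-weaken C₁ (δ-item V) C₂ (types-unique C₁≈C₁′ d₁ d₂))
  var-types-unique E≈E′ (t-def {C₁ = C₁} {V} {C₂} refl _) (t-decl {C₁ = C₁′} {W′} {C₂′} refl _) i≡j
    with _ , () ← ·-≈-injective C₁ (δ-item V) C₂ C₁′ (λ-item W′) C₂′ E≈E′ i≡j
  var-types-unique E≈E′ (t-decl {C₁ = C₁} {W} {C₂} refl _) (t-def {C₁ = C₁′} {V′} {C₂′} refl _) i≡j
    with _ , () ← ·-≈-injective C₁ (λ-item W) C₂ C₁′ (δ-item V′) C₂′ E≈E′ i≡j
  var-types-unique E≈E′ (t-decl {C₁ = C₁} {W} {C₂} refl _) (t-decl {C₁ = C₁′} {W′} {C₂′} refl _) i≡j
    with _ , refl ← ·-≈-injective C₁ (λ-item W) C₂ C₁′ (λ-item W′) C₂′ E≈E′ i≡j =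
    subst (λ k → C₁ · λ-item W · C₂ ⊢ lift (suc (binders C₂)) 0 W ⇔ lift (suc k) 0 W) i≡j ⇔-refl

mainTheorem7 : (g : ℕ → ℕ) → (∀ h → h < g h) →
               ∀ {C T T₁ T₂} → C ⊢[ g ] T ∶ T₁ → C ⊢[ g ] T ∶ T₂ →
               C ⊢ T₁ ⇔ T₂
mainTheorem7 g _ d₁ d₂ = types-unique refl d₁ d₂
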